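{- Let $t>3$ be an odd integer. Then $\chi_2(G_t)=5$ if $t\equiv 1$ or $9 \pmod{10}$, and $\chi_2(G_t)=6$ if $t\equiv 3,5$ or $7\pmod{10}$. Moreover, $\chi_2(G_3)=7$.
   Context: For an odd integer $t\ge 3$, $G_t$ denotes the integer distance graph $G(\mathbb{Z},\{2,t\})$: its vertex set is $\mathbb{Z}$, and distinct $i,j\in\mathbb{Z}$ are adjacent if and only if $|i-j|\in\{2,t\}$. For a graph $G$, a $2$-distance $k$-coloring is a map $f:V(G)\to\{1,\ldots,k\}$ such that any two distinct vertices $u,v$ with $f(u)=f(v)$ satisfy $d_G(u,v)>2$ ($d_G$ the shortest-path distance); $\chi_2(G)$ is the smallest such $k$. -}

module Defs where

open import Data.Nat using (ℕ; _≤_; _%_)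
open import Data.Integer using (ℤ; +_; _-_; ∣_∣)
open import Data.Fin using (Fin)
open import Data.Product using (_×_; ∃)
open import Data.Sum using (_⊎_)
open import Relation.Nullary using (¬_)
open import Relation.Binary.PropositionalEquality using (_≡_; _≢_)

record Graph : Set₁ where
  field
    V   : Set
    Adj : V → V → Set

open Graph public

DistLe2 : (G : Graph) → V G → V G → Set
DistLe2 G u v = u ≡ v ⊎ Adj G u v ⊎ ∃ λ w → Adj G u w × Adj G w v

Is2DistColoring : (G : Graph) (k : ℕ) → (V G → Fin k) → Set
Is2DistColoring G k f =
  ∀ u v → u ≢ v → f u ≡ f v → ¬ DistLe2 G u v

TwoDistColorable : Graph → ℕ → Set
TwoDistColorable G k = ∃ λ (f : V G → Fin k) → Is2DistColoring G k f

Chi2≡ : Graph → ℕ → Set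
Chi2≡ G k = TwoDistColorable G k × (∀ m → TwoDistColorable G m → k ≤ m)

G : ℕ → Graph
G t = record
  { V   = ℤ
  ; Adj = λ i j → i ≢ j × (∣ i - j ∣ ≡ 2 ⊎ ∣ i - j ∣ ≡ t)
  }

-- Restricted to ℕ, a 2-distance colouring of G t is a sequence s with
-- s n ≢ s (n + δ) for every gap δ ∈ {2, 4, t, t + 2, 2t, t - 2}.  Conversely, a
-- P-periodic sequence whose values differ at distances 1, …, 4 colours G t as soon
-- as t ≡ ±1 (mod P), since every gap is then ±1, …, ±4 modulo P.  Residues mod 5
-- handle t ≡ 1, 9 (mod 10), residues mod 6 handle t ≡ 1, 5 (mod 6), and for
-- t ≡ 3 (mod 6) the period t + 1 is filled by the blocks 01234 01234 (012345)*.
-- For t = 3 the residues mod 7 work.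
--
-- The closed neighbourhood of a vertex is a clique of the square graph, so five
-- colours are needed, and seven in G 3, where 0, …, 6 are pairwise at distance at
-- most 2.  Pulling a 5-colouring back along (a , b) ↦ a t + 2 b to the square grid,
-- a finite search shows that it is 10-periodic.  If t ≡ 5 (mod 10) this contradicts
-- 2t ≡ 0, and if t ≡ 3, 7 (mod 10) every distance 1, …, 5 is a gap modulo 10, so
-- 0, …, 5 would need six colours.

module Submission where

open import Defs
open import Algebra.Bundles using (AbelianGroup)
open import Data.Bool using (Bool; true; false; T; not; _∧_; _∨_)
open import Data.Bool.ListAction using (all)
open import Data.Bool.Properties using (T-∨; T-not-≡)
open import Data.Empty using (⊥-elim)
open import Data.Fin using (Fin; fromℕ<; toℕ)
import Data.Fin as Fin
open import Data.Fin.Properties using (fromℕ<-injective; injective⇒≤; toℕ<n)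
import Data.Fin.Properties as Fin
open import Data.Integer as ℤ using (ℤ; +_; -[1+_]; _-_; ∣_∣)
open import Data.Integer.DivMod using (_%ℕ_; _/ℕ_; a≡a%ℕn+[a/ℕn]*n)
import Data.Integer.Properties as ℤP
open import Data.Integer.Tactic.RingSolver using (solve-∀)
open import Data.List as List using (List; []; _∷_; allFin)
open import Data.List.Membership.Propositional using (_∈_)
open import Data.List.Membership.Propositional.Properties using (∈-allFin)
open import Data.List.Relation.Unary.Any using (here; there)
import Data.List.Relation.Unary.All as All
open import Data.List.Relation.Unary.All.Properties using (all⁺)
open import Data.Nat as ℕ using (ℕ; zero; suc; _≤_; _<_; _%_; _/_; z≤n; s≤s)
open import Data.Nat.DivMod
  using (m%n<n; m<n⇒m%n≡m; n%1≡0; n%n≡0; %-distribˡ-+; [m+kn]%n≡m%n; [m+n]%n≡m%n; m≡m%n+[m/n]*n)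
import Data.Nat.Properties as ℕP
import Data.Nat.Tactic.RingSolver as ℕRing
import Data.Product
open import Data.Product using (_×_; _,_; ∃)
open import Data.Product.Properties using (≡-dec)
import Data.Sum
open import Data.Sum using (_⊎_; inj₁; inj₂)
open import Data.Vec using (Vec; []; _∷_)
open import Data.Vec.Relation.Unary.All using ([]; _∷_)
open import Data.Vec.Relation.Unary.AllPairs using (AllPairs; []; _∷_)
import Data.Vec.Relation.Unary.AllPairs as AllPairs
open import Data.Vec.Relation.Unary.AllPairs.Properties using (map⁺)
open import Data.Vec.Relation.Unary.Unique.Propositional.Properties using (lookup-injective)
open import Function using (_∘_)
open import Function.Bundles using (Equivalence)
open import Relation.Binary.Definitions using (tri<; tri≈; tri>; DecidableEquality)
open import Relation.Binary.PropositionalEquality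
open import Relation.Nullary using (¬_; Dec; does; contradiction; yes; no; _⊎-dec_)
open import Algebra.Properties.CommutativeSemigroup ℕP.+-commutativeSemigroup using (xy∙z≈xz∙y)
open import Algebra.Properties.Group (AbelianGroup.group ℤP.+-0-abelianGroup) using (∙-cancelˡ; ∙-cancelʳ)

-- Distance at most 2 in G t

data Step (t : ℕ) : ℕ → Set where
  short : Step t 2
  long  : Step t t

-- v - u for vertices u < v at distance at most 2 in G t; 'back' is the
-- difference t - 2, written without truncated subtraction.
data Gap (t : ℕ) : ℕ → Set where
  one  : ∀ {d} → Step t d → Gap t d
  two  : ∀ {d e} → Step t d → Step t e → Gap t (d ℕ.+ e)
  back : ∀ {δ} → δ ℕ.+ 2 ≡ t → Gap t δ

Separates : {A : Set} → (ℕ → A) → ℕ → Set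
Separates s r = ∀ n → s n ≢ s (n ℕ.+ r)

Separated : {A : Set} → ℕ → (ℕ → A) → Set
Separated t s = ∀ {δ} → Gap t δ → Separates s δ

Ahead : ℕ → ℕ → ℕ → Set
Ahead t x y = ∃ λ δ → Gap t δ × x ℕ.+ δ ≡ y

Aheadℤ : ℕ → ℤ → ℤ → Set
Aheadℤ t u v = ∃ λ δ → Gap t δ × v ≡ u ℤ.+ + δ

separated-apart : ∀ {A : Set} {t} {s : ℕ → A} → Separated t s → ∀ {x y} → Ahead t x y → s x ≢ s y
separated-apart {s = s} sep {x} (δ , g , x+δ≡y) = subst (λ y → s x ≢ s y) x+δ≡y (sep g x)

x≢x+d : ∀ x {d} → d ≢ 0 → x ≢ x ℤ.+ + d
x≢x+d x d≢0 x≡x+d = d≢0 (sym (ℤP.+-injective (∙-cancelˡ x (+ 0) _ (trans (ℤP.+-identityʳ x) x≡x+d))))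

∣i∣≡n⇒i≡±n : ∀ i {n} → ∣ i ∣ ≡ n → i ≡ + n ⊎ i ≡ ℤ.- + n
∣i∣≡n⇒i≡±n (+ n)    refl = inj₁ refl
∣i∣≡n⇒i≡±n -[1+ n ] refl = inj₂ refl

∣x-[x+d]∣≡d : ∀ x d → ∣ x - (x ℤ.+ + d) ∣ ≡ d
∣x-[x+d]∣≡d x d = trans (cong ∣_∣ (x-[x+y]≡-y x (+ d))) (ℤP.∣-i∣≡∣i∣ (+ d))
  where x-[x+y]≡-y : ∀ x y → x - (x ℤ.+ y) ≡ ℤ.- y
        x-[x+y]≡-y = solve-∀

∣u-v∣≡d⇒± : ∀ {u v d} → ∣ u - v ∣ ≡ d → v ≡ u ℤ.+ + d ⊎ u ≡ v ℤ.+ + d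
∣u-v∣≡d⇒± {u} {v} {d} length with ∣i∣≡n⇒i≡±n (u - v) length
... | inj₁ u-v≡d  = inj₂ (trans (u≡v+[u-v] u v) (cong (λ i → v ℤ.+ i) u-v≡d))
  where u≡v+[u-v] : ∀ u v → u ≡ v ℤ.+ (u - v)
        u≡v+[u-v] = solve-∀
... | inj₂ u-v≡-d = inj₁ (trans (trans (v≡u-[u-v] u v) (cong (λ i → u ℤ.+ ℤ.- i) u-v≡-d))
                     (cong (λ i → u ℤ.+ i) (ℤP.neg-involutive (+ d))))
  where v≡u-[u-v] : ∀ u v → v ≡ u ℤ.+ ℤ.- (u - v)
        v≡u-[u-v] = solve-∀

module _ {t : ℕ} (3≤t : 3 ≤ t) where

  step-nonzero : ∀ {d} → Step t d → d ≢ 0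
  step-nonzero short ()
  step-nonzero long  t≡0 with () ← subst (3 ≤_) t≡0 3≤t

  gap-nonzero : ∀ {δ} → Gap t δ → δ ≢ 0
  gap-nonzero (one s)        = step-nonzero s
  gap-nonzero (two short _)  ()
  gap-nonzero (two long _)   = step-nonzero long ∘ ℕP.m+n≡0⇒m≡0 t
  gap-nonzero (back 2≡t) refl with s≤s (s≤s ()) ← subst (3 ≤_) (sym 2≡t) 3≤t

  adjacent : ∀ {d} → Step t d → ∀ x → Adj (G t) x (x ℤ.+ + d)
  adjacent short x = x≢x+d x (step-nonzero short) , inj₁ (∣x-[x+d]∣≡d x 2)
  adjacent long  x = x≢x+d x (step-nonzero long)  , inj₂ (∣x-[x+d]∣≡d x t)

  adjacent-sym : ∀ {u v} → Adj (G t) u v → Adj (G t) v u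
  adjacent-sym {u} {v} (u≢v , length) =
    u≢v ∘ sym , Data.Sum.map (trans (ℤP.∣i-j∣≡∣j-i∣ v u)) (trans (ℤP.∣i-j∣≡∣j-i∣ v u)) length

  gap⇒dist≤2 : ∀ {δ} → Gap t δ → ∀ x → DistLe2 (G t) x (x ℤ.+ + δ)
  gap⇒dist≤2 (one s) x = inj₂ (inj₁ (adjacent s x))
  gap⇒dist≤2 (two {d} {e} s s′) x =
    inj₂ (inj₂ (x ℤ.+ + d , adjacent s x ,
      subst (Adj (G t) _) (ℤP.+-assoc x (+ d) (+ e)) (adjacent s′ (x ℤ.+ + d))))
  gap⇒dist≤2 (back {δ} δ+2≡t) x =
    inj₂ (inj₂ (x ℤ.+ + t , adjacent long x ,
      adjacent-sym (subst (Adj (G t) _) x+δ+2≡x+t (adjacent short (x ℤ.+ + δ)))))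
    where
    x+δ+2≡x+t : x ℤ.+ + δ ℤ.+ + 2 ≡ x ℤ.+ + t
    x+δ+2≡x+t = trans (ℤP.+-assoc x (+ δ) (+ 2)) (cong (λ n → x ℤ.+ + n) δ+2≡t)

  colouring⇒separated : ∀ {k f} → Is2DistColoring (G t) k f → Separated t (λ n → f (+ n))
  colouring⇒separated col g n =
    λ eq → col (+ n) _ (x≢x+d (+ n) (gap-nonzero g)) eq (gap⇒dist≤2 g (+ n))

  adjacent⇒step : ∀ {u v} → Adj (G t) u v →
                  ∃ λ d → Step t d × (v ≡ u ℤ.+ + d ⊎ u ≡ v ℤ.+ + d)
  adjacent⇒step (_ , inj₁ length) = 2 , short , ∣u-v∣≡d⇒± length
  adjacent⇒step (_ , inj₂ length) = t , long  , ∣u-v∣≡d⇒± length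

  long-over-short : ∀ {x y} → x ℤ.+ + t ≡ y ℤ.+ + 2 → Aheadℤ t x y
  long-over-short {x} {y} x+t≡y+2 =
    t ℕ.∸ 2 , back t∸2+2≡t , ∙-cancelʳ (+ 2) y (x ℤ.+ + (t ℕ.∸ 2)) (begin
      y ℤ.+ + 2                      ≡⟨ sym x+t≡y+2 ⟩
      x ℤ.+ + t                      ≡⟨ cong (λ n → x ℤ.+ + n) (sym t∸2+2≡t) ⟩
      x ℤ.+ + (t ℕ.∸ 2 ℕ.+ 2)        ≡⟨ sym (ℤP.+-assoc x (+ (t ℕ.∸ 2)) (+ 2)) ⟩
      x ℤ.+ + (t ℕ.∸ 2) ℤ.+ + 2      ∎)
    where
    open ≡-Reasoning
    t∸2+2≡t : t ℕ.∸ 2 ℕ.+ 2 ≡ t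
    t∸2+2≡t = ℕP.m∸n+n≡m (ℕP.≤-trans (ℕP.n≤1+n 2) 3≤t)

  fork : ∀ {x y d e} → x ≢ y → Step t d → Step t e → x ℤ.+ + d ≡ y ℤ.+ + e →
         Aheadℤ t x y ⊎ Aheadℤ t y x
  fork x≢y short short eq = contradiction (∙-cancelʳ (+ 2) _ _ eq) x≢y
  fork x≢y long  long  eq = contradiction (∙-cancelʳ (+ t) _ _ eq) x≢y
  fork {x} {y} _ long  short eq = inj₁ (long-over-short {x} {y} eq)
  fork {x} {y} _ short long  eq = inj₂ (long-over-short {y} {x} (sym eq))

  dist≤2⇒ahead : ∀ {u v} → u ≢ v → DistLe2 (G t) u v → Aheadℤ t u v ⊎ Aheadℤ t v u
  dist≤2⇒ahead u≢v (inj₁ u≡v) = contradiction u≡v u≢v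
  dist≤2⇒ahead u≢v (inj₂ (inj₁ uv)) with adjacent⇒step uv
  ... | d , s , inj₁ v≡u+d = inj₁ (d , one s , v≡u+d)
  ... | d , s , inj₂ u≡v+d = inj₂ (d , one s , u≡v+d)
  dist≤2⇒ahead {u} {v} u≢v (inj₂ (inj₂ (w , uw , wv)))
    with adjacent⇒step uw | adjacent⇒step wv
  ... | d , s , inj₁ w≡u+d | e , s′ , inj₁ v≡w+e =
    inj₁ (d ℕ.+ e , two s s′ ,
          trans v≡w+e (trans (cong (λ i → i ℤ.+ + e) w≡u+d) (ℤP.+-assoc u (+ d) (+ e))))
  ... | d , s , inj₂ u≡w+d | e , s′ , inj₂ w≡v+e =
    inj₂ (e ℕ.+ d , two s′ s ,
          trans u≡w+d (trans (cong (λ i → i ℤ.+ + d) w≡v+e) (ℤP.+-assoc v (+ e) (+ d))))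
  ... | d , s , inj₁ w≡u+d | e , s′ , inj₂ w≡v+e = fork u≢v s s′ (trans (sym w≡u+d) w≡v+e)
  ... | d , s , inj₂ u≡w+d | e , s′ , inj₁ v≡w+e = fork u≢v s′ s (begin
    u ℤ.+ + e          ≡⟨ cong (λ i → i ℤ.+ + e) u≡w+d ⟩
    w ℤ.+ + d ℤ.+ + e  ≡⟨ ℤP.+-assoc w (+ d) (+ e) ⟩
    w ℤ.+ + (d ℕ.+ e)  ≡⟨ cong (λ n → w ℤ.+ + n) (ℕP.+-comm d e) ⟩
    w ℤ.+ + (e ℕ.+ d)  ≡⟨ ℤP.+-assoc w (+ e) (+ d) ⟨
    w ℤ.+ + e ℤ.+ + d  ≡⟨ cong (λ i → i ℤ.+ + d) v≡w+e ⟨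
    v ℤ.+ + d          ∎)
    where open ≡-Reasoning

-- Colourings from periodic sequences

Periodic : {A : Set} → ℕ → (ℕ → A) → Set
Periodic P s = ∀ n → s (n ℕ.+ P) ≡ s n

module _ {A : Set} {P : ℕ} {s : ℕ → A} (per : Periodic P s) where

  periodic-+* : ∀ n q → s (n ℕ.+ q ℕ.* P) ≡ s n
  periodic-+* n zero    = cong s (ℕP.+-identityʳ n)
  periodic-+* n (suc q) = begin
    s (n ℕ.+ (P ℕ.+ q ℕ.* P))  ≡⟨ cong s (n+[P+m]≡n+m+P n P (q ℕ.* P)) ⟩
    s (n ℕ.+ q ℕ.* P ℕ.+ P)    ≡⟨ per _ ⟩
    s (n ℕ.+ q ℕ.* P)          ≡⟨ periodic-+* n q ⟩
    s n                        ∎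
    where open ≡-Reasoning
          n+[P+m]≡n+m+P : ∀ n P m → n ℕ.+ (P ℕ.+ m) ≡ n ℕ.+ m ℕ.+ P
          n+[P+m]≡n+m+P = ℕRing.solve-∀

  separates-+* : ∀ {r} → Separates s r → ∀ q → Separates s (r ℕ.+ q ℕ.* P)
  separates-+* {r} sep q n sn≡s[n+r+qP] = sep n (begin
    s n                          ≡⟨ sn≡s[n+r+qP] ⟩
    s (n ℕ.+ (r ℕ.+ q ℕ.* P))    ≡⟨ cong s (sym (ℕP.+-assoc n r _)) ⟩
    s (n ℕ.+ r ℕ.+ q ℕ.* P)      ≡⟨ periodic-+* (n ℕ.+ r) q ⟩
    s (n ℕ.+ r)                  ∎)
    where open ≡-Reasoning

  separates-reduce : ∀ {r} q → Separates s (r ℕ.+ q ℕ.* P) → Separates s r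
  separates-reduce {r} q sep n sn≡s[n+r] = sep n (begin
    s n                          ≡⟨ sn≡s[n+r] ⟩
    s (n ℕ.+ r)                  ≡⟨ periodic-+* (n ℕ.+ r) q ⟨
    s (n ℕ.+ r ℕ.+ q ℕ.* P)      ≡⟨ cong s (ℕP.+-assoc n r _) ⟩
    s (n ℕ.+ (r ℕ.+ q ℕ.* P))    ∎)
    where open ≡-Reasoning

  separates-opposite : ∀ {r r′} q → r′ ℕ.+ r ≡ q ℕ.* P → Separates s r → Separates s r′
  separates-opposite {r} {r′} q r′+r≡qP sep n sn≡s[n+r′] = sep (n ℕ.+ r′) (begin
    s (n ℕ.+ r′)                 ≡⟨ sn≡s[n+r′] ⟨
    s n                          ≡⟨ periodic-+* n q ⟨
    s (n ℕ.+ q ℕ.* P)            ≡⟨ cong (λ m → s (n ℕ.+ m)) r′+r≡qP ⟨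
    s (n ℕ.+ (r′ ℕ.+ r))         ≡⟨ cong s (ℕP.+-assoc n r′ r) ⟨
    s (n ℕ.+ r′ ℕ.+ r)           ∎)
    where open ≡-Reasoning

  periodic-ℤ : ∀ a b q → + a ≡ + b ℤ.+ q ℤ.* + P → s a ≡ s b
  periodic-ℤ a b (+ n) a≡b+nP = trans (cong s (ℤP.+-injective a≡b+nP′)) (periodic-+* b n)
    where a≡b+nP′ : + a ≡ + (b ℕ.+ n ℕ.* P)
          a≡b+nP′ = trans a≡b+nP (cong (λ i → + b ℤ.+ i) (sym (ℤP.pos-* n P)))
  periodic-ℤ a b -[1+ n ] a≡b-mP = sym (periodic-ℤ b a (+ suc n) (begin
    + b                                              ≡⟨ b≡[b-mP]+mP (+ b) (+ suc n) (+ P) ⟩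
    + b ℤ.+ ℤ.- (+ suc n) ℤ.* + P ℤ.+ + suc n ℤ.* + P ≡⟨ cong (λ i → i ℤ.+ + suc n ℤ.* + P) a≡b-mP ⟨
    + a ℤ.+ + suc n ℤ.* + P                          ∎))
    where open ≡-Reasoning
          b≡[b-mP]+mP : ∀ b m p → b ≡ b ℤ.+ ℤ.- m ℤ.* p ℤ.+ m ℤ.* p
          b≡[b-mP]+mP = solve-∀

  periodic-%ℕ : .{{_ : ℕ.NonZero P}} → ∀ u δ → s ((u ℤ.+ + δ) %ℕ P) ≡ s (u %ℕ P ℕ.+ δ)
  periodic-%ℕ u δ = periodic-ℤ _ _ (q - q′) (begin
    r′                                ≡⟨ r≡[r+qp]-qp r′ q′ p ⟩
    r′ ℤ.+ q′ ℤ.* p - q′ ℤ.* p          ≡⟨ cong (λ i → i - q′ ℤ.* p) (a≡a%ℕn+[a/ℕn]*n v P) ⟨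
    u ℤ.+ + δ - q′ ℤ.* p                ≡⟨ cong (λ i → i ℤ.+ + δ - q′ ℤ.* p) (a≡a%ℕn+[a/ℕn]*n u P) ⟩
    r ℤ.+ q ℤ.* p ℤ.+ + δ - q′ ℤ.* p    ≡⟨ regroup r q q′ (+ δ) p ⟩
    r ℤ.+ + δ ℤ.+ (q - q′) ℤ.* p        ∎)
    where
    open ≡-Reasoning
    v = u ℤ.+ + δ
    p = + P
    r = + (u %ℕ P)
    q = u /ℕ P
    r′ = + (v %ℕ P)
    q′ = v /ℕ P
    r≡[r+qp]-qp : ∀ r q p → r ≡ r ℤ.+ q ℤ.* p - q ℤ.* p
    r≡[r+qp]-qp = solve-∀
    regroup : ∀ r q q′ d p → r ℤ.+ q ℤ.* p ℤ.+ d - q′ ℤ.* p ≡ r ℤ.+ d ℤ.+ (q - q′) ℤ.* p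
    regroup = solve-∀

periodic-separated⇒colourable : ∀ {t k P} .{{_ : ℕ.NonZero P}} → 3 ≤ t →
  (c : ℕ → ℕ) → (∀ n → c n < k) → Periodic P c → Separated t c → TwoDistColorable (G t) k
periodic-separated⇒colourable {t} {k} {P} 3≤t c c<k per sep = colour , proper
  where
  colour : ℤ → Fin k
  colour u = fromℕ< (c<k (u %ℕ P))

  clash : ∀ u v {δ} → Gap t δ → v ≡ u ℤ.+ + δ → colour u ≢ colour v
  clash u v {δ} g refl cu≡cv =
    sep g (u %ℕ P) (trans (fromℕ<-injective _ _ (c<k _) (c<k _) cu≡cv) (periodic-%ℕ per u δ))

  proper : Is2DistColoring (G t) k colour
  proper u v u≢v cu≡cv dist with dist≤2⇒ahead 3≤t u≢v dist
  ... | inj₁ (δ , g , v≡u+δ) = clash u v g v≡u+δ cu≡cv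
  ... | inj₂ (δ , g , u≡v+δ) = clash v u g u≡v+δ (sym cu≡cv)

module _ {A : Set} {P : ℕ} {s : ℕ → A} (per : Periodic P s)
         (sep≤4 : ∀ {e} → 0 < e → e ≤ 4 → Separates s e) where

  private
    sep₁ : Separates s 1
    sep₁ = sep≤4 (s≤s z≤n) (s≤s z≤n)
    sep₂ : Separates s 2
    sep₂ = sep≤4 (s≤s z≤n) (s≤s (s≤s z≤n))
    sep₃ : Separates s 3
    sep₃ = sep≤4 (s≤s z≤n) (s≤s (s≤s (s≤s z≤n)))
    sep₄ : Separates s 4
    sep₄ = sep≤4 (s≤s z≤n) (s≤s (s≤s (s≤s (s≤s z≤n))))

  ≡1+qP⇒separated : ∀ {t} q → t ≡ 1 ℕ.+ q ℕ.* P → Separated t s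
  ≡1+qP⇒separated q refl (one short)       = sep₂
  ≡1+qP⇒separated q refl (one long)        = separates-+* per sep₁ q
  ≡1+qP⇒separated q refl (two short short) = sep₄
  ≡1+qP⇒separated q refl (two short long)  = separates-+* per sep₃ q
  ≡1+qP⇒separated q refl (two long short)  =
    subst (Separates s) (ℕP.+-comm 2 (1 ℕ.+ q ℕ.* P)) (separates-+* per sep₃ q)
  ≡1+qP⇒separated q refl (two long long)   =
    subst (Separates s) (sym (t+t≡2+[q+q]P q P)) (separates-+* per sep₂ (q ℕ.+ q))
    where t+t≡2+[q+q]P : ∀ q P → (1 ℕ.+ q ℕ.* P) ℕ.+ (1 ℕ.+ q ℕ.* P) ≡ 2 ℕ.+ (q ℕ.+ q) ℕ.* P
          t+t≡2+[q+q]P = ℕRing.solve-∀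
  ≡1+qP⇒separated q refl (back {δ} δ+2≡t)  =
    separates-opposite per q (ℕP.suc-injective (trans (sym (ℕP.+-suc δ 1)) δ+2≡t)) sep₁

  t+1≡qP⇒separated : ∀ {t} q → t ℕ.+ 1 ≡ q ℕ.* P → Separated t s
  t+1≡qP⇒separated     q t+1≡qP (one short)       = sep₂
  t+1≡qP⇒separated     q t+1≡qP (one long)        = separates-opposite per q t+1≡qP sep₁
  t+1≡qP⇒separated     q t+1≡qP (two short short) = sep₄
  t+1≡qP⇒separated {t} q t+1≡qP (two short long)  =
    subst (Separates s) (cong suc (trans (sym t+1≡qP) (ℕP.+-comm t 1))) (separates-+* per sep₁ q)
  t+1≡qP⇒separated {t} q t+1≡qP (two long short)  =
    subst (Separates s) (trans (cong suc (trans (sym t+1≡qP) (ℕP.+-comm t 1))) (ℕP.+-comm 2 t))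
      (separates-+* per sep₁ q)
  t+1≡qP⇒separated {t} q t+1≡qP (two long long)   =
    separates-opposite per (q ℕ.+ q) (trans ([t+t]+2≡[t+1]+[t+1] t)
      (trans (cong₂ ℕ._+_ t+1≡qP t+1≡qP) (sym (ℕP.*-distribʳ-+ P q q)))) sep₂
    where [t+t]+2≡[t+1]+[t+1] : ∀ t → t ℕ.+ t ℕ.+ 2 ≡ (t ℕ.+ 1) ℕ.+ (t ℕ.+ 1)
          [t+t]+2≡[t+1]+[t+1] = ℕRing.solve-∀
  t+1≡qP⇒separated     q t+1≡qP (back {δ} δ+2≡t)  =
    separates-opposite per q (trans (sym (ℕP.+-assoc δ 2 1)) (trans (cong (ℕ._+ 1) δ+2≡t) t+1≡qP)) sep₃

Counter : ℕ → (ℕ → ℕ) → Set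
Counter L c = ∀ n → c (suc n) ≡ suc (c n) ⊎ (c (suc n) ≡ 0 × L ≤ c n)

module _ {L : ℕ} {c : ℕ → ℕ} (counter : Counter L c) where

  -- A reset only happens from a value ≥ L, so afterwards the counter lags by more than L.
  counter-drift : ∀ n e → c (n ℕ.+ e) ≡ c n ℕ.+ e ⊎ c (n ℕ.+ e) ℕ.+ suc L ≤ c n ℕ.+ e
  counter-drift n zero = inj₁ (trans (cong c (ℕP.+-identityʳ n)) (sym (ℕP.+-identityʳ (c n))))
  counter-drift n (suc e) rewrite ℕP.+-suc n e | ℕP.+-suc (c n) e
    with counter-drift n e | counter (n ℕ.+ e)
  ... | inj₁ c[n+e]≡cn+e | inj₁ step          = inj₁ (trans step (cong suc c[n+e]≡cn+e))
  ... | inj₁ c[n+e]≡cn+e | inj₂ (reset , L≤)  =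
    inj₂ (subst (λ i → i ℕ.+ suc L ≤ suc (c n ℕ.+ e)) (sym reset) (s≤s (subst (L ≤_) c[n+e]≡cn+e L≤)))
  ... | inj₂ behind      | inj₁ step          =
    inj₂ (subst (λ i → i ℕ.+ suc L ≤ suc (c n ℕ.+ e)) (sym step) (s≤s behind))
  ... | inj₂ behind      | inj₂ (reset , _)   =
    inj₂ (subst (λ i → i ℕ.+ suc L ≤ suc (c n ℕ.+ e)) (sym reset)
                (ℕP.m≤n⇒m≤1+n (ℕP.m+n≤o⇒n≤o (c (n ℕ.+ e)) behind)))

  counter-separates : ∀ {e} → 0 < e → e ≤ L → Separates c e
  counter-separates {e} 0<e e≤L n cn≡c[n+e] with counter-drift n e
  ... | inj₁ c[n+e]≡cn+e = ℕP.<⇒≢ 0<e (ℕP.+-cancelˡ-≡ (c n) 0 e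
                                      (trans (ℕP.+-identityʳ (c n)) (trans cn≡c[n+e] c[n+e]≡cn+e)))
  ... | inj₂ behind      = ℕP.<⇒≱ (s≤s e≤L) (ℕP.+-cancelˡ-≤ (c n) _ _
                             (subst (λ i → i ℕ.+ suc L ≤ c n ℕ.+ e) (sym cn≡c[n+e]) behind))

mod-counter : ∀ L → Counter L (_% suc L)
mod-counter zero    n = inj₂ (n%1≡0 (suc n) , z≤n)
mod-counter (suc L) n with ℕP.m≤n⇒m<n∨m≡n (m%n<n n (2 ℕ.+ L))
... | inj₁ 1+r<d = inj₁ (trans (%-distribˡ-+ 1 n (2 ℕ.+ L)) (m<n⇒m%n≡m 1+r<d))
... | inj₂ 1+r≡d =
  inj₂ ( trans (%-distribˡ-+ 1 n (2 ℕ.+ L)) (trans (cong (_% (2 ℕ.+ L)) 1+r≡d) (n%n≡0 (2 ℕ.+ L)))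
       , ℕP.≤-reflexive (ℕP.suc-injective (sym 1+r≡d)))

-- Two blocks 0 1 2 3 4 followed by blocks 0 1 2 3 4 5 (for p ≥ 10, p + 2 ≡ p - 10 mod 6).
block : ℕ → ℕ
block p with p ℕ.<? 10
... | yes _ = p % 5
... | no  _ = (p ℕ.+ 2) % 6

block-low : ∀ {p} → p < 10 → block p ≡ p % 5
block-low {p} p<10 with p ℕ.<? 10
... | yes _   = refl
... | no p≮10 = contradiction p<10 p≮10

block-high : ∀ {p} → 10 ≤ p → block p ≡ (p ℕ.+ 2) % 6
block-high {p} 10≤p with p ℕ.<? 10
... | yes p<10 = contradiction 10≤p (ℕP.<⇒≱ p<10)
... | no  _    = refl

block<6 : ∀ p → block p < 6
block<6 p with p ℕ.<? 10
... | yes _ = ℕP.m≤n⇒m≤1+n (m%n<n p 5)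
... | no  _ = m%n<n (p ℕ.+ 2) 6

block-counter : Counter 4 block
block-counter p with ℕP.<-cmp p 9
... | tri< p<9 _ _ rewrite block-low (s≤s p<9) | block-low (ℕP.m<n⇒m<1+n p<9) = mod-counter 4 p
... | tri≈ _ refl _ = inj₂ (refl , ℕP.≤-refl)
... | tri> _ _ 9<p rewrite block-high (ℕP.m≤n⇒m≤1+n 9<p) | block-high 9<p =
  Data.Sum.map₂ (Data.Product.map₂ (ℕP.≤-trans (ℕP.n≤1+n 4))) (mod-counter 5 (p ℕ.+ 2))

block-cycle-counter : ∀ j → Counter 4 (λ n → block (n % (16 ℕ.+ j ℕ.* 6)))
block-cycle-counter j n with mod-counter (15 ℕ.+ j ℕ.* 6) n
... | inj₁ step rewrite step = block-counter (n % P)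
  where P = 16 ℕ.+ j ℕ.* 6
... | inj₂ (wrap , P-1≤r) rewrite wrap =
  inj₂ (refl , ℕP.≤-trans (ℕP.n≤1+n 4) (ℕP.≤-reflexive (sym last≡5)))
  where
  P = 16 ℕ.+ j ℕ.* 6
  r≡P-1 : n % P ≡ 15 ℕ.+ j ℕ.* 6
  r≡P-1 = ℕP.≤-antisym (ℕP.≤-pred (m%n<n n P)) P-1≤r
  last≡5 : block (n % P) ≡ 5
  last≡5 = begin
    block (n % P)                        ≡⟨ cong block r≡P-1 ⟩
    block (15 ℕ.+ j ℕ.* 6)               ≡⟨ block-high {15 ℕ.+ j ℕ.* 6} (ℕP.m≤n⇒m≤o+n 5 (ℕP.m≤m+n 10 _)) ⟩
    (15 ℕ.+ j ℕ.* 6 ℕ.+ 2) % 6            ≡⟨ cong (_% 6) (regroup j) ⟩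
    (5 ℕ.+ (2 ℕ.+ j) ℕ.* 6) % 6           ≡⟨ [m+kn]%n≡m%n 5 (2 ℕ.+ j) 6 ⟩
    5                                    ∎
    where open ≡-Reasoning
          regroup : ∀ j → 15 ℕ.+ j ℕ.* 6 ℕ.+ 2 ≡ 5 ℕ.+ (2 ℕ.+ j) ℕ.* 6
          regroup = ℕRing.solve-∀

cyclic-colourable : ∀ {t} L → 4 ≤ L → 3 ≤ t →
  (∃ λ q → t ≡ 1 ℕ.+ q ℕ.* suc L) ⊎ (∃ λ q → t ℕ.+ 1 ≡ q ℕ.* suc L) →
  TwoDistColorable (G t) (suc L)
cyclic-colourable {t} L 4≤L 3≤t t≡±1 =
  periodic-separated⇒colourable 3≤t (_% suc L) (λ n → m%n<n n (suc L)) per (separated t≡±1)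
  where
  per : Periodic (suc L) (_% suc L)
  per n = [m+n]%n≡m%n n (suc L)
  sep≤4 : ∀ {e} → 0 < e → e ≤ 4 → Separates (_% suc L) e
  sep≤4 0<e e≤4 = counter-separates (mod-counter L) 0<e (ℕP.≤-trans e≤4 4≤L)
  separated : (∃ λ q → t ≡ 1 ℕ.+ q ℕ.* suc L) ⊎ (∃ λ q → t ℕ.+ 1 ≡ q ℕ.* suc L) →
              Separated t (_% suc L)
  separated (inj₁ (q , t≡1+qP)) = ≡1+qP⇒separated per sep≤4 q t≡1+qP
  separated (inj₂ (q , t+1≡qP)) = t+1≡qP⇒separated per sep≤4 q t+1≡qP

block-colourable : ∀ {t} j → t ≡ 15 ℕ.+ j ℕ.* 6 → TwoDistColorable (G t) 6
block-colourable j refl =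
  periodic-separated⇒colourable (ℕP.≤-trans (ℕP.m≤m+n 3 12) (ℕP.m≤m+n 15 _))
    cycle (λ n → block<6 (n % P)) per (t+1≡qP⇒separated per sep≤4 1 (t+1≡P j))
  where
  P = 16 ℕ.+ j ℕ.* 6
  cycle : ℕ → ℕ
  cycle n = block (n % P)
  per : Periodic P cycle
  per n = cong block ([m+n]%n≡m%n n P)
  sep≤4 : ∀ {e} → 0 < e → e ≤ 4 → Separates cycle e
  sep≤4 = counter-separates (block-cycle-counter j)
  t+1≡P : ∀ j → 15 ℕ.+ j ℕ.* 6 ℕ.+ 1 ≡ 1 ℕ.* (16 ℕ.+ j ℕ.* 6)
  t+1≡P = ℕRing.solve-∀

G₃-colourable : TwoDistColorable (G 3) 7
G₃-colourable = periodic-separated⇒colourable ℕP.≤-refl (_% 7) (λ n → m%n<n n 7) per separated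
  where
  per : Periodic 7 (_% 7)
  per n = [m+n]%n≡m%n n 7
  gap≤6 : ∀ {δ} → Gap 3 δ → δ ≤ 6
  gap≤6 (one short)       = ℕP.≤ᵇ⇒≤ 2 6 _
  gap≤6 (one long)        = ℕP.≤ᵇ⇒≤ 3 6 _
  gap≤6 (two short short) = ℕP.≤ᵇ⇒≤ 4 6 _
  gap≤6 (two short long)  = ℕP.≤ᵇ⇒≤ 5 6 _
  gap≤6 (two long short)  = ℕP.≤ᵇ⇒≤ 5 6 _
  gap≤6 (two long long)   = ℕP.≤-refl
  gap≤6 {δ} (back δ+2≡3)  =
    ℕP.≤-trans (ℕP.m≤m+n δ 2) (ℕP.≤-trans (ℕP.≤-reflexive δ+2≡3) (ℕP.≤ᵇ⇒≤ 3 6 _))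
  separated : Separated 3 (_% 7)
  separated g = counter-separates (mod-counter 6) (ℕP.n≢0⇒n>0 (gap-nonzero ℕP.≤-refl g)) (gap≤6 g)

-- Lower bounds

-- The closed neighbourhood of t + 2 in G t.
neighbourhood : ℕ → Vec ℕ 5
neighbourhood t = 2 ∷ t ∷ t ℕ.+ 2 ∷ t ℕ.+ 2 ℕ.+ 2 ∷ t ℕ.+ 2 ℕ.+ t ∷ []

neighbourhood-apart : ∀ u → AllPairs (Ahead (2 ℕ.+ u)) (neighbourhood (2 ℕ.+ u))
neighbourhood-apart u =
    ( (u , back (ℕP.+-comm u 2) , refl)
    ∷ (t , one long , ℕP.+-comm 2 t)
    ∷ (t ℕ.+ 2 , two long short , ℕP.+-comm 2 (t ℕ.+ 2))
    ∷ (t ℕ.+ t , two long long , trans (sym (ℕP.+-assoc 2 t t)) (cong (ℕ._+ t) (ℕP.+-comm 2 t)))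
    ∷ [])
  ∷ ( (2 , one short , refl)
    ∷ (4 , two short short , sym (ℕP.+-assoc t 2 2))
    ∷ (t ℕ.+ 2 , two long short , ℕP.+-comm t (t ℕ.+ 2))
    ∷ [])
  ∷ ((2 , one short , refl) ∷ (t , one long , refl) ∷ [])
  ∷ ((u , back (ℕP.+-comm u 2) , ℕP.+-assoc (t ℕ.+ 2) 2 u) ∷ [])
  ∷ []
  ∷ []
  where t = 2 ℕ.+ u

separated⇒5≤ : ∀ {t k} → 2 ≤ t → (s : ℕ → Fin k) → Separated t s → 5 ≤ k
separated⇒5≤ {suc (suc u)} (s≤s (s≤s z≤n)) s sep =
  injective⇒≤ (lookup-injective (map⁺ (AllPairs.map (separated-apart sep) (neighbourhood-apart u))) _ _)

separates-prefix⇒≤ : ∀ {k} n (s : ℕ → Fin k) → (∀ {r} → 0 < r → r < n → Separates s r) → n ≤ k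
separates-prefix⇒≤ n s sep = injective⇒≤ injective
  where
  apart : ∀ {i j : Fin n} → toℕ i < toℕ j → s (toℕ i) ≢ s (toℕ j)
  apart {i} {j} i<j = subst (λ m → s (toℕ i) ≢ s m) (ℕP.m+[n∸m]≡n (ℕP.<⇒≤ i<j))
    (sep (ℕP.m<n⇒0<n∸m i<j) (ℕP.≤-<-trans (ℕP.m∸n≤m (toℕ j) (toℕ i)) (toℕ<n j)) (toℕ i))
  injective : ∀ {i j : Fin n} → s (toℕ i) ≡ s (toℕ j) → i ≡ j
  injective {i} {j} eq with Fin.<-cmp i j
  ... | tri< i<j _ _ = contradiction eq (apart i<j)
  ... | tri≈ _ i≡j _ = i≡j
  ... | tri> _ _ j<i = contradiction (sym eq) (apart j<i)

separated-shift : ∀ {A : Set} {t} {s : ℕ → A} m → Separated t s → Separated t (λ n → s (m ℕ.+ n))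
separated-shift {s = s} m sep g n eq =
  sep g (m ℕ.+ n) (trans eq (cong s (sym (ℕP.+-assoc m n _))))

-- Five colourings are 10-periodic

-- refutes ps ρ is a backtracking search for a colouring of the points ps that
-- extends ρ and gives clashing points distinct colours; true means there is none.
module Backtracking {P : Set} {Clash : P → P → Set} (clash? : ∀ p q → Dec (Clash p q)) (k : ℕ) where

  fits : Fin k → P → List (P × Fin k) → Bool
  fits c p = all λ (q , c′) → not (does (clash? p q) ∧ does (c Fin.≟ c′))

  refutes : List P → List (P × Fin k) → Bool
  refutes []       _ = false
  refutes (p ∷ ps) ρ = all (λ c → not (fits c p ρ) ∨ refutes ps ((p , c) ∷ ρ)) (allFin k)

  module _ (σ : P → Fin k) (proper : ∀ {p q} → Clash p q → σ p ≢ σ q) where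

    graph : List P → List (P × Fin k)
    graph = List.map λ q → q , σ q

    fits-graph : ∀ p qs → T (fits (σ p) p (graph qs))
    fits-graph p []       = _
    fits-graph p (q ∷ qs) with clash? p q | σ p Fin.≟ σ q
    ... | yes c | yes σp≡σq = contradiction σp≡σq (proper c)
    ... | yes _ | no  _     = fits-graph p qs
    ... | no  _ | _         = fits-graph p qs

    refutes-sound : ∀ ps qs → ¬ T (refutes ps (graph qs))
    refutes-sound (p ∷ ps) qs none
      with Equivalence.to T-∨ (All.lookup (all⁺ _ (allFin k) none) (∈-allFin (σ p)))
    ... | inj₁ unfit   = subst T (Equivalence.to T-not-≡ unfit) (fits-graph p qs)
    ... | inj₂ none′   = refutes-sound ps (p ∷ qs) none′

Point : Set
Point = ℕ × ℕ

-- The grid point (a , b) stands for a t + 2 b, so grid neighbours are adjacent in G t.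
height : ℕ → Point → ℕ
height t (zero  , b) = b ℕ.* 2
height t (suc a , b) = height t (a , b) ℕ.+ t

height-+b : ∀ t a b db → height t (a , db ℕ.+ b) ≡ height t (a , b) ℕ.+ db ℕ.* 2
height-+b t zero    b db = trans (ℕP.*-distribʳ-+ 2 db b) (ℕP.+-comm (db ℕ.* 2) (b ℕ.* 2))
height-+b t (suc a) b db = trans (cong (ℕ._+ t) (height-+b t a b db)) (xy∙z≈xz∙y (height t (a , b)) (db ℕ.* 2) t)

height-+ : ∀ t a b da db → height t (da ℕ.+ a , db ℕ.+ b) ≡ height t (a , b) ℕ.+ height t (da , db)
height-+ t a b zero     db = height-+b t a b db
height-+ t a b (suc da) db =
  trans (cong (ℕ._+ t) (height-+ t a b da db)) (ℕP.+-assoc (height t (a , b)) (height t (da , db)) t)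

square : Point → List Point
square (a , b) = (a , suc b) ∷ (a , 2 ℕ.+ b) ∷ (suc a , b) ∷ (suc a , suc b) ∷ (2 ℕ.+ a , b) ∷ []

ahead : Point → List Point
ahead (a , zero)  = square (a , zero)
ahead (a , suc b) = (suc a , b) ∷ square (a , suc b)

square-apart : ∀ {t p q} → q ∈ square p → Ahead t (height t p) (height t q)
square-apart {t} {a , b} (here refl) =
  2 , one short , sym (height-+ t a b 0 1)
square-apart {t} {a , b} (there (here refl)) =
  4 , two short short , sym (height-+ t a b 0 2)
square-apart {t} {a , b} (there (there (here refl))) =
  t , one long , sym (height-+ t a b 1 0)
square-apart {t} {a , b} (there (there (there (here refl)))) =
  2 ℕ.+ t , two short long , sym (height-+ t a b 1 1)
square-apart {t} {a , b} (there (there (there (there (here refl))))) =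
  t ℕ.+ t , two long long , sym (height-+ t a b 2 0)

ahead-apart : ∀ u {p q} → q ∈ ahead p → Ahead (2 ℕ.+ u) (height (2 ℕ.+ u) p) (height (2 ℕ.+ u) q)
ahead-apart u {a , zero}  q∈square          = square-apart q∈square
ahead-apart u {a , suc b} (here refl)       =
  u , back (ℕP.+-comm u 2) ,
  trans (cong (ℕ._+ u) (height-+ (2 ℕ.+ u) a b 0 1)) (ℕP.+-assoc (height (2 ℕ.+ u) (a , b)) 2 u)
ahead-apart u {a , suc b} (there q∈square)  = square-apart q∈square

_≟ₚ_ : DecidableEquality Point
_≟ₚ_ = ≡-dec ℕ._≟_ ℕ._≟_

open import Data.List.Membership.DecPropositional _≟ₚ_ using (_∈?_)

GridClash : Point → Point → Set
GridClash p q = q ∈ ahead p ⊎ p ∈ ahead q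

gridClash? : ∀ p q → Dec (GridClash p q)
gridClash? p q = (q ∈? ahead p) ⊎-dec (p ∈? ahead q)

module _ {u : ℕ} (s : ℕ → Fin 5) (sep : Separated (2 ℕ.+ u) s) (n : ℕ) where

  lift : Point → Fin 5
  lift p = s (n ℕ.+ height (2 ℕ.+ u) p)

  lift-proper : ∀ {p q} → GridClash p q → lift p ≢ lift q
  lift-proper (inj₁ q∈ahead) = separated-apart (separated-shift n sep) (ahead-apart u q∈ahead)
  lift-proper (inj₂ p∈ahead) = lift-proper (inj₁ p∈ahead) ∘ sym

  strip : List Point
  strip = (1 , 0) ∷ (1 , 2) ∷ (1 , 1) ∷ (0 , 1) ∷ (2 , 1) ∷ (0 , 2) ∷ (2 , 2)
        ∷ (1 , 3) ∷ (0 , 3) ∷ (2 , 3) ∷ (1 , 4) ∷ (0 , 4) ∷ (2 , 4) ∷ (1 , 5) ∷ []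

  -- By exhaustive search over the 14 points of the strip [0, 2] × [0, 5]:
  -- no 2-distance 5-colouring of the grid separates (1 , 0) from (1 , 5).
  lift-repeats : lift (1 , 5) ≡ lift (1 , 0)
  lift-repeats with lift (1 , 5) Fin.≟ lift (1 , 0)
  ... | yes repeats = repeats
  ... | no  differ  = ⊥-elim (Backtracking.refutes-sound clash? 5 lift proper strip [] _)
    where
    Clash : Point → Point → Set
    Clash p q = GridClash p q ⊎ (p , q) ≡ ((1 , 5) , (1 , 0))
    clash? : ∀ p q → Dec (Clash p q)
    clash? p q = gridClash? p q ⊎-dec ≡-dec _≟ₚ_ _≟ₚ_ (p , q) ((1 , 5) , (1 , 0))
    proper : ∀ {p q} → Clash p q → lift p ≢ lift q
    proper (inj₁ c)    = lift-proper c
    proper (inj₂ refl) = differ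

five-colouring-periodic : ∀ {t} → 2 ≤ t → (s : ℕ → Fin 5) → Separated t s → Periodic 10 (λ n → s (t ℕ.+ n))
five-colouring-periodic {suc (suc u)} (s≤s (s≤s z≤n)) s sep n = begin
  s (t ℕ.+ (n ℕ.+ 10))   ≡⟨ cong s (t+[n+10]≡n+[10+t] t n) ⟩
  lift s sep n (1 , 5)   ≡⟨ lift-repeats s sep n ⟩
  lift s sep n (1 , 0)   ≡⟨ cong s (ℕP.+-comm n t) ⟩
  s (t ℕ.+ n)            ∎
  where
  open ≡-Reasoning
  t = 2 ℕ.+ u
  t+[n+10]≡n+[10+t] : ∀ t n → t ℕ.+ (n ℕ.+ 10) ≡ n ℕ.+ (10 ℕ.+ t)
  t+[n+10]≡n+[10+t] = ℕRing.solve-∀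

residue₃-prefix : ∀ {A : Set} {s : ℕ → A} q → Periodic 10 s → Separated (3 ℕ.+ q ℕ.* 10) s →
                  ∀ {e} → 0 < e → e < 6 → Separates s e
residue₃-prefix q per sep {1} _ _ = separates-reduce per q (sep (back (ℕP.+-comm (1 ℕ.+ q ℕ.* 10) 2)))
residue₃-prefix q per sep {2} _ _ = sep (one short)
residue₃-prefix q per sep {3} _ _ = separates-reduce per q (sep (one long))
residue₃-prefix q per sep {4} _ _ = sep (two short short)
residue₃-prefix q per sep {5} _ _ = separates-reduce per q (sep (two short long))
residue₃-prefix q per sep {suc (suc (suc (suc (suc (suc _)))))} _ (s≤s (s≤s (s≤s (s≤s (s≤s (s≤s ()))))))

residue₇-prefix : ∀ {A : Set} {s : ℕ → A} q → Periodic 10 s → Separated (7 ℕ.+ q ℕ.* 10) s →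
                  ∀ {e} → 0 < e → e < 6 → Separates s e
residue₇-prefix q per sep {1} _ _ = separates-opposite per 1 refl (separates-reduce per q (sep (two short long)))
residue₇-prefix q per sep {2} _ _ = sep (one short)
residue₇-prefix q per sep {3} _ _ = separates-opposite per 1 refl (separates-reduce per q (sep (one long)))
residue₇-prefix q per sep {4} _ _ = sep (two short short)
residue₇-prefix q per sep {5} _ _ = separates-reduce per q (sep (back (ℕP.+-comm (5 ℕ.+ q ℕ.* 10) 2)))
residue₇-prefix q per sep {suc (suc (suc (suc (suc (suc _)))))} _ (s≤s (s≤s (s≤s (s≤s (s≤s (s≤s ()))))))

periodic-five-colouring-impossible : ∀ {t r q} → r ≡ 3 ⊎ r ≡ 5 ⊎ r ≡ 7 → t ≡ r ℕ.+ q ℕ.* 10 →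
  (s : ℕ → Fin 5) → Periodic 10 s → ¬ Separated t s
periodic-five-colouring-impossible {q = q} (inj₁ refl) refl s per sep =
  ℕP.<-irrefl refl (separates-prefix⇒≤ 6 s (residue₃-prefix q per sep))
periodic-five-colouring-impossible {q = q} (inj₂ (inj₁ refl)) refl s per sep =
  separates-reduce per (1 ℕ.+ (q ℕ.+ q)) (subst (Separates s) (t+t≡[1+q+q]*10 q) (sep (two long long))) 0 refl
  where t+t≡[1+q+q]*10 : ∀ q → (5 ℕ.+ q ℕ.* 10) ℕ.+ (5 ℕ.+ q ℕ.* 10) ≡ 0 ℕ.+ (1 ℕ.+ (q ℕ.+ q)) ℕ.* 10
        t+t≡[1+q+q]*10 = ℕRing.solve-∀
periodic-five-colouring-impossible {q = q} (inj₂ (inj₂ refl)) refl s per sep =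
  ℕP.<-irrefl refl (separates-prefix⇒≤ 6 s (residue₇-prefix q per sep))

no-five-colouring : ∀ {t r q} → 3 ≤ t → r ≡ 3 ⊎ r ≡ 5 ⊎ r ≡ 7 → t ≡ r ℕ.+ q ℕ.* 10 →
                    (s : ℕ → Fin 5) → ¬ Separated t s
no-five-colouring {t} {q = q} 3≤t r≡3∨5∨7 t≡r+10q s sep =
  periodic-five-colouring-impossible {q = q} r≡3∨5∨7 t≡r+10q (λ n → s (t ℕ.+ n))
    (five-colouring-periodic (ℕP.≤-trans (ℕP.n≤1+n 2) 3≤t) s sep) (separated-shift t sep)

χ₂≥5 : ∀ {t} → 3 ≤ t → ∀ m → TwoDistColorable (G t) m → 5 ≤ m
χ₂≥5 3≤t m (f , col) = separated⇒5≤ (ℕP.≤-trans (ℕP.n≤1+n 2) 3≤t) _ (colouring⇒separated 3≤t col)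

χ₂≥6 : ∀ {t} → 3 ≤ t → (t % 10 ≡ 3 ⊎ t % 10 ≡ 5 ⊎ t % 10 ≡ 7) →
       ∀ m → TwoDistColorable (G t) m → 6 ≤ m
χ₂≥6 {t} 3≤t r≡3∨5∨7 m (f , col) with ℕP.m≤n⇒m<n∨m≡n (χ₂≥5 3≤t m (f , col))
... | inj₁ 5<m = 5<m
... | inj₂ refl =
  ⊥-elim (no-five-colouring {q = t / 10} 3≤t r≡3∨5∨7 (m≡m%n+[m/n]*n t 10) _ (colouring⇒separated 3≤t col))

separated₃-prefix : ∀ {A : Set} {s : ℕ → A} → Separated 3 s → ∀ {r} → 0 < r → r < 7 → Separates s r
separated₃-prefix sep {1} _ _ = sep (back refl)
separated₃-prefix sep {2} _ _ = sep (one short)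
separated₃-prefix sep {3} _ _ = sep (one long)
separated₃-prefix sep {4} _ _ = sep (two short short)
separated₃-prefix sep {5} _ _ = sep (two short long)
separated₃-prefix sep {6} _ _ = sep (two long long)
separated₃-prefix sep {suc (suc (suc (suc (suc (suc (suc _))))))} _
  (s≤s (s≤s (s≤s (s≤s (s≤s (s≤s (s≤s ())))))))

χ₂[G₃]≥7 : ∀ m → TwoDistColorable (G 3) m → 7 ≤ m
χ₂[G₃]≥7 m (f , col) = separates-prefix⇒≤ 7 _ (separated₃-prefix (colouring⇒separated ℕP.≤-refl col))

colourable₅ : ∀ {t} → 3 ≤ t → (t % 10 ≡ 1 ⊎ t % 10 ≡ 9) → TwoDistColorable (G t) 5
colourable₅ {t} 3≤t r≡1∨9 = cyclic-colourable 4 ℕP.≤-refl 3≤t (±1 r≡1∨9)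
  where
  q = t / 10
  t≡r+10q : t ≡ t % 10 ℕ.+ q ℕ.* 10
  t≡r+10q = m≡m%n+[m/n]*n t 10
  ±1 : (t % 10 ≡ 1 ⊎ t % 10 ≡ 9) →
       (∃ λ q′ → t ≡ 1 ℕ.+ q′ ℕ.* 5) ⊎ (∃ λ q′ → t ℕ.+ 1 ≡ q′ ℕ.* 5)
  ±1 (inj₁ r≡1) = inj₁ (q ℕ.+ q , trans t≡r+10q (trans (cong (ℕ._+ q ℕ.* 10) r≡1) (1+10q≡1+[q+q]5 q)))
    where 1+10q≡1+[q+q]5 : ∀ q → 1 ℕ.+ q ℕ.* 10 ≡ 1 ℕ.+ (q ℕ.+ q) ℕ.* 5
          1+10q≡1+[q+q]5 = ℕRing.solve-∀
  ±1 (inj₂ r≡9) = inj₂ (2 ℕ.+ (q ℕ.+ q) , trans (cong (ℕ._+ 1) (trans t≡r+10q (cong (ℕ._+ q ℕ.* 10) r≡9)))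
                                                (9+10q+1≡[2+q+q]5 q))
    where 9+10q+1≡[2+q+q]5 : ∀ q → 9 ℕ.+ q ℕ.* 10 ℕ.+ 1 ≡ (2 ℕ.+ (q ℕ.+ q)) ℕ.* 5
          9+10q+1≡[2+q+q]5 = ℕRing.solve-∀

odd-residue₆ : ∀ r → r < 6 → r % 2 ≡ 1 → r ≡ 1 ⊎ r ≡ 3 ⊎ r ≡ 5
odd-residue₆ 1 _ _ = inj₁ refl
odd-residue₆ 3 _ _ = inj₂ (inj₁ refl)
odd-residue₆ 5 _ _ = inj₂ (inj₂ refl)
odd-residue₆ 0 _ ()
odd-residue₆ 2 _ ()
odd-residue₆ 4 _ ()
odd-residue₆ (suc (suc (suc (suc (suc (suc _)))))) (s≤s (s≤s (s≤s (s≤s (s≤s (s≤s ())))))) _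

colourable₆-by-residue : ∀ {t r q} → r ≡ 1 ⊎ r ≡ 3 ⊎ r ≡ 5 → t ≡ r ℕ.+ q ℕ.* 6 → 3 < t →
  (t % 10 ≡ 3 ⊎ t % 10 ≡ 5 ⊎ t % 10 ≡ 7) → TwoDistColorable (G t) 6
colourable₆-by-residue {q = q} (inj₁ refl) refl 3<t _ =
  cyclic-colourable 5 (ℕP.n≤1+n 4) (ℕP.<⇒≤ 3<t) (inj₁ (q , refl))
colourable₆-by-residue {q = q} (inj₂ (inj₂ refl)) refl 3<t _ =
  cyclic-colourable 5 (ℕP.n≤1+n 4) (ℕP.<⇒≤ 3<t) (inj₂ (suc q , ℕP.+-comm (5 ℕ.+ q ℕ.* 6) 1))
colourable₆-by-residue {q = 0} (inj₂ (inj₁ refl)) refl 3<t _ = contradiction 3<t (ℕP.<-irrefl refl)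
colourable₆-by-residue {q = 1} (inj₂ (inj₁ refl)) refl _ (inj₁ ())
colourable₆-by-residue {q = 1} (inj₂ (inj₁ refl)) refl _ (inj₂ (inj₁ ()))
colourable₆-by-residue {q = 1} (inj₂ (inj₁ refl)) refl _ (inj₂ (inj₂ ()))
colourable₆-by-residue {q = suc (suc j)} (inj₂ (inj₁ refl)) refl _ _ =
  block-colourable j (3+[2+j]6≡15+6j j)
  where 3+[2+j]6≡15+6j : ∀ j → 3 ℕ.+ (2 ℕ.+ j) ℕ.* 6 ≡ 15 ℕ.+ j ℕ.* 6
        3+[2+j]6≡15+6j = ℕRing.solve-∀

colourable₆ : ∀ {t} → t % 2 ≡ 1 → 3 < t → (t % 10 ≡ 3 ⊎ t % 10 ≡ 5 ⊎ t % 10 ≡ 7) →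
              TwoDistColorable (G t) 6
colourable₆ {t} odd 3<t r≡3∨5∨7 =
  colourable₆-by-residue {q = t / 6} (odd-residue₆ (t % 6) (m%n<n t 6) (trans (sym t%2≡r%2) odd))
                          (m≡m%n+[m/n]*n t 6) 3<t r≡3∨5∨7
  where
  t%2≡r%2 : t % 2 ≡ t % 6 % 2
  t%2≡r%2 = trans (cong (_% 2) (trans (m≡m%n+[m/n]*n t 6) (cong (t % 6 ℕ.+_) (sym (ℕP.*-assoc (t / 6) 3 2)))))
                  ([m+kn]%n≡m%n (t % 6) (t / 6 ℕ.* 3) 2)

χ₂≡5 : ∀ {t} → 3 ≤ t → (t % 10 ≡ 1 ⊎ t % 10 ≡ 9) → Chi2≡ (G t) 5
χ₂≡5 3≤t r≡1∨9 = colourable₅ 3≤t r≡1∨9 , χ₂≥5 3≤t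

χ₂≡6 : ∀ {t} → t % 2 ≡ 1 → 3 < t → (t % 10 ≡ 3 ⊎ t % 10 ≡ 5 ⊎ t % 10 ≡ 7) → Chi2≡ (G t) 6
χ₂≡6 odd 3<t r≡3∨5∨7 = colourable₆ odd 3<t r≡3∨5∨7 , χ₂≥6 (ℕP.<⇒≤ 3<t) r≡3∨5∨7

χ₂[G₃]≡7 : Chi2≡ (G 3) 7
χ₂[G₃]≡7 = G₃-colourable , χ₂[G₃]≥7

theorem9 : ((t : ℕ) → t % 2 ≡ 1 → 3 < t →
               ((t % 10 ≡ 1 ⊎ t % 10 ≡ 9) → Chi2≡ (G t) 5)
             × ((t % 10 ≡ 3 ⊎ t % 10 ≡ 5 ⊎ t % 10 ≡ 7) → Chi2≡ (G t) 6))
           × Chi2≡ (G 3) 7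
theorem9 = (λ t odd 3<t → χ₂≡5 (ℕP.<⇒≤ 3<t) , χ₂≡6 odd 3<t) , χ₂[G₃]≡7
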